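{- Let $f\colon\mathbb{N}_0\to\mathbb{N}_0$ be a multiplicative arithmetic function (i.e. $f(1)=1$ and $f(mn)=f(m)f(n)$ whenever $m,n\in\mathbb{N}$ are coprime) such that for all primes $p$ and positive integers $\alpha$: (I) $f(p^{\alpha})<p^{\alpha}$; (II) $f(p)\mid f(p^{\alpha})$; (III) if $q$ is a prime with $q\mid f(p^{\alpha})$, then $q\mid p\,f(p)$; and moreover (IV) $f(0)=0$. For $n\in\mathbb{N}$ let $H(n)=\lim_{m\to\infty} f^m(n)$. Then the function $H\colon\mathbb{N}\to\{0,1\}$ is completely multiplicative, i.e. $H(xy)=H(x)H(y)$ for all $x,y\in\mathbb{N}$.
   Context: $\mathbb{N}$ denotes the positive integers and $\mathbb{N}_0$ the nonnegative integers. $f^0(n)=n$ and $f^{k+1}(n)=f(f^k(n))$ for all nonnegative integers $k,n$. Under the hypotheses, for each $n\in\mathbb{N}$ the sequence $f^m(n)$ is eventually constant with value $f^n(n)\in\{0,1\}$, so $H(n)=f^n(n)$ is well defined and lies in $\{0,1\}$. -}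

module Defs where

open import Data.Nat using (ℕ; zero; suc; _*_; _^_; _<_; _≥_)
open import Data.Nat.Divisibility using (_∣_)
open import Data.Nat.Coprimality using (Coprime)
open import Data.Nat.Primality using (Prime)
open import Relation.Binary.PropositionalEquality using (_≡_)
open import Data.Product using (_×_)

iter : (ℕ → ℕ) → ℕ → ℕ → ℕ
iter f zero n = n
iter f (suc k) n = f (iter f k n)

Multiplicative : (ℕ → ℕ) → Set
Multiplicative f =
  (f 1 ≡ 1) × ((m n : ℕ) → m ≥ 1 → n ≥ 1 → Coprime m n → f (m * n) ≡ f m * f n)

-- H(n) = f^n(n), the eventual value of the orbit of n (see context)
H : (ℕ → ℕ) → ℕ → ℕ
H f n = iter f n n

module Submission where

-- Doomedness moves between n, f n = f (p ^ a) * f m, p and m, using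
--     (II) for p ^ a → f p and (III) for f (p ^ a) → p * f p.
--  6. Since H takes values in {0, 1}, 3 and 5 give H f (x * y) = H f x * H f y.

open import Defs
open import Data.Nat
  using (ℕ; zero; suc; _+_; _∸_; _*_; _^_; _<_; _≤_; _≥_; z≤n; s≤s; _≤?_; _≟_; >-nonZero; nonTrivial⇒n>1)
open import Data.Nat.Properties
open import Data.Nat.Divisibility
  using (_∣_; _∤_; divides; _∣?_; ∣-trans; ∣⇒≤; ∣1⇒≡1; ∣m+n∣m⇒∣n; n∣m*n; m∣m*n; _∣0)
open import Data.Nat.Primality using (Prime; prime[2]; euclidsLemma; prime⇒irreducible; prime⇒nonTrivial; prime⇒nonZero; ¬prime[0]; ¬prime[1])
open import Data.Nat.Primality.Factorisation using (factorise; PrimeFactorisation)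
open import Data.Nat.Coprimality using (Coprime)
open import Data.Nat.Induction using (<-rec)
open import Data.Nat.ListAction using (product)
open import Data.List using (List; []; _∷_)
open import Data.List.Relation.Unary.All using (All; _∷_)
open import Data.Product using (_×_; _,_; proj₁; proj₂; ∃-syntax)
open import Data.Sum using (_⊎_; inj₁; inj₂; [_,_]; map)
open import Data.Sum.Function.Propositional using (_⊎-⇔_)
open import Function.Base using (case_of_)
open import Function.Bundles using (_⇔_; mk⇔; Equivalence)
open import Function.Properties.Equivalence using () renaming (trans to ⇔-trans; sym to ⇔-sym)
open import Relation.Nullary using (¬_; yes; no; contradiction)
open import Relation.Binary.PropositionalEquality hiding ([_])

prime≥2 : ∀ {p} → Prime p → p ≥ 2
prime≥2 {p} pp = nonTrivial⇒n>1 p {{prime⇒nonTrivial pp}}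

primeDivisor : ∀ {n} → n ≢ 1 → ∃[ q ] (Prime q × q ∣ n)
primeDivisor {zero} _ = 2 , prime[2] , 2 ∣0
primeDivisor {suc zero} n≢1 = contradiction refl n≢1
primeDivisor {n@(suc (suc _))} n≢1 = headOf (factors F) (isFactorisation F) (factorsPrime F)
  where
  open PrimeFactorisation
  F = factorise n
  headOf : (ps : List ℕ) → n ≡ product ps → All Prime ps → ∃[ q ] (Prime q × q ∣ n)
  headOf [] n≡1 _ = contradiction n≡1 n≢1
  headOf (q ∷ qs) n≡ (pq ∷ _) = q , pq , subst (q ∣_) (sym n≡) (m∣m*n (product qs))

-- A number divisible by every prime is 0 (a prime divisor of c + 1 would
-- divide 1).
divisibleByAllPrimes⇒0 : ∀ {c} → (∀ q → Prime q → q ∣ c) → c ≡ 0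
divisibleByAllPrimes⇒0 {zero} _ = refl
divisibleByAllPrimes⇒0 {suc c} all with primeDivisor {suc (suc c)} (λ ())
... | q , pq , q∣c+2 = contradiction (∣1⇒≡1 q∣1) (λ q≡1 → ¬prime[1] (subst Prime q≡1 pq))
  where
  q∣1 : q ∣ 1
  q∣1 = ∣m+n∣m⇒∣n (subst (q ∣_) (+-comm 1 (suc c)) q∣c+2) (all q pq)

primeDivisorOfPrime : ∀ {p q} → Prime p → Prime q → q ∣ p → q ≡ p
primeDivisorOfPrime pp pq q∣p with prime⇒irreducible pp q∣p
... | inj₁ q≡1 = contradiction (subst Prime q≡1 pq) ¬prime[1]
... | inj₂ q≡p = q≡p

primeDivisorOfPower : ∀ {p q} a → Prime p → Prime q → q ∣ p ^ a → q ≡ p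
primeDivisorOfPower zero pp pq q∣1 = contradiction (subst Prime (∣1⇒≡1 q∣1) pq) ¬prime[1]
primeDivisorOfPower {p} (suc a) pp pq q∣pᵃ⁺¹ with euclidsLemma p (p ^ a) pq q∣pᵃ⁺¹
... | inj₁ q∣p = primeDivisorOfPrime pp pq q∣p
... | inj₂ q∣pᵃ = primeDivisorOfPower a pp pq q∣pᵃ

-- A common divisor d ≠ 1 of p ^ a and m would have a prime divisor, which
-- must be p, contradicting p ∤ m.
coprimePower : ∀ {p m} a → Prime p → p ∤ m → Coprime (p ^ a) m
coprimePower {p} {m} a pp p∤m {d} (d∣pᵃ , d∣m) with d ≟ 1
... | yes d≡1 = d≡1
... | no d≢1 with primeDivisor d≢1
...   | q , pq , q∣d = contradiction (subst (_∣ m) q≡p (∣-trans q∣d d∣m)) p∤m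
  where
  q≡p : q ≡ p
  q≡p = primeDivisorOfPower a pp pq (∣-trans q∣d d∣pᵃ)

removePrimePower : ∀ {p} → Prime p → ∀ n → n ≥ 1 → ∃[ a ] ∃[ m ] (n ≡ p ^ a * m × p ∤ m)
removePrimePower {p} pp = <-rec _ go
  where
  go : ∀ n → (∀ {k} → k < n → k ≥ 1 → ∃[ a ] ∃[ m ] (k ≡ p ^ a * m × p ∤ m))
     → n ≥ 1 → ∃[ a ] ∃[ m ] (n ≡ p ^ a * m × p ∤ m)
  go n rec n≥1 with p ∣? n
  ... | no p∤n = 0 , n , sym (*-identityˡ n) , p∤n
  ... | yes (divides zero n≡0) = contradiction n≡0 (>⇒≢ n≥1)
  ... | yes (divides k@(suc _) n≡kp) with rec (subst (k <_) (sym n≡kp) (m<m*n k p (prime≥2 pp))) (s≤s z≤n)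
  ...   | a , m , k≡pᵃm , p∤m = suc a , m , n≡pᵃ⁺¹m , p∤m
    where
    open ≡-Reasoning
    n≡pᵃ⁺¹m : n ≡ p ^ suc a * m
    n≡pᵃ⁺¹m = begin
      n             ≡⟨ n≡kp ⟩
      k * p         ≡⟨ *-comm k p ⟩
      p * k         ≡⟨ cong (p *_) k≡pᵃm ⟩
      p * (p ^ a * m) ≡⟨ *-assoc p (p ^ a) m ⟨
      p ^ suc a * m ∎

primePower≥2 : ∀ {p} a → Prime p → a ≥ 1 → p ^ a ≥ 2
primePower≥2 {p} (suc a) pp _ = ≤-trans (prime≥2 pp) (m≤m*n p (p ^ a))
  where instance _ = m^n≢0 p a {{prime⇒nonZero pp}}

record PrimePowerSplit (n : ℕ) : Set where
  field
    p a m : ℕ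
    prime : Prime p
    a≥1 : a ≥ 1
    m≥1 : m ≥ 1
    n≡pᵃm : n ≡ p ^ a * m
    coprime : Coprime (p ^ a) m
    p∣n : p ∣ n

  pᵃ≥2 : p ^ a ≥ 2
  pᵃ≥2 = primePower≥2 a prime a≥1

  m∣n : m ∣ n
  m∣n = subst (m ∣_) (sym n≡pᵃm) (n∣m*n (p ^ a))

  m<n : m < n
  m<n = subst (m <_) (trans (*-comm m (p ^ a)) (sym n≡pᵃm)) (m<m*n m (p ^ a) {{>-nonZero m≥1}} pᵃ≥2)

primePowerSplit : ∀ n → n ≥ 2 → PrimePowerSplit n
primePowerSplit n n≥2 with primeDivisor (>⇒≢ n≥2)
... | p , pp , p∣n with removePrimePower pp n (≤-trans (s≤s z≤n) n≥2)
...   | zero , m , n≡m , p∤m = contradiction (subst (p ∣_) (trans n≡m (*-identityˡ m)) p∣n) p∤m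
...   | suc a , zero , _ , p∤0 = contradiction (p ∣0) p∤0
...   | suc a , m@(suc _) , n≡pᵃm , p∤m = record
  { p = p ; a = suc a ; m = m ; prime = pp ; a≥1 = s≤s z≤n ; m≥1 = s≤s z≤n
  ; n≡pᵃm = n≡pᵃm ; coprime = coprimePower (suc a) pp p∤m ; p∣n = p∣n }

module Descent
    (f : ℕ → ℕ)
    (fixesSmall : ∀ {c} → c ≤ 1 → f c ≡ c)
    (decreases : ∀ {n} → n ≥ 2 → f n < n)
  where

  f-le : ∀ n → f n ≤ n
  f-le n with n ≤? 1
  ... | yes n≤1 = ≤-reflexive (fixesSmall n≤1)
  ... | no n≰1 = <⇒≤ (decreases (≰⇒> n≰1))

  orbitDescends : ∀ k n → iter f k n ≤ 1 ⊎ k + iter f k n ≤ n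
  orbitDescends zero n = inj₂ ≤-refl
  orbitDescends (suc k) n with iter f k n ≤? 1 | orbitDescends k n
  ... | yes small | _ = inj₁ (≤-trans (≤-reflexive (fixesSmall small)) small)
  ... | no big | inj₁ small = contradiction small big
  ... | no big | inj₂ dropped = inj₂ (begin
    suc k + f x   ≡⟨ +-suc k (f x) ⟨
    k + suc (f x) ≤⟨ +-monoʳ-≤ k (decreases (≰⇒> big)) ⟩
    k + x         ≤⟨ dropped ⟩
    n             ∎)
    where
    open ≤-Reasoning
    x = iter f k n

  -- Within n steps the orbit of n enters {0, 1} or drops by n to 0.
  H≤1 : ∀ n → H f n ≤ 1
  H≤1 n with orbitDescends n n
  ... | inj₁ small = small
  ... | inj₂ dropped = ≤-trans (+-cancelˡ-≤ n (H f n) 0 (subst (n + H f n ≤_) (sym (+-identityʳ n)) dropped)) z≤n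

  iterStable : ∀ k n → n ≤ k → iter f k n ≡ H f n
  iterStable k n n≤k = subst (λ t → iter f t n ≡ H f n) (m∸n+n≡m n≤k) (stable (k ∸ n))
    where
    stable : ∀ j → iter f (j + n) n ≡ H f n
    stable zero = refl
    stable (suc j) = trans (cong f (stable j)) (fixesSmall (H≤1 n))

  iterShift : ∀ k n → iter f (suc k) n ≡ iter f k (f n)
  iterShift zero n = refl
  iterShift (suc k) n = cong f (iterShift k n)

  H-invariant : ∀ n → H f (f n) ≡ H f n
  H-invariant n = begin
    iter f (f n) (f n) ≡⟨ iterStable n (f n) (f-le n) ⟨
    iter f n (f n)     ≡⟨ iterShift n n ⟨
    iter f (suc n) n   ≡⟨ iterStable (suc n) n (n≤1+n n) ⟩
    H f n              ∎
    where open ≡-Reasoning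

Doomed : (ℕ → ℕ) → ℕ → Set
Doomed g n = n ≡ 0 ⊎ ∃[ q ] (Prime q × q ∣ n × g q ≡ 0)

module _ {g : ℕ → ℕ} where

  doomed-transfer : ∀ {x y} → (∀ q → Prime q → q ∣ x → q ∣ y) → Doomed g x → Doomed g y
  doomed-transfer primesOf (inj₁ refl) = inj₁ (divisibleByAllPrimes⇒0 λ q pq → primesOf q pq (q ∣0))
  doomed-transfer primesOf (inj₂ (q , pq , q∣x , gq≡0)) = inj₂ (q , pq , primesOf q pq q∣x , gq≡0)

  doomed-∣ : ∀ {x y} → x ∣ y → Doomed g x → Doomed g y
  doomed-∣ x∣y = doomed-transfer λ _ _ q∣x → ∣-trans q∣x x∣y

  ¬doomed-1 : ¬ Doomed g 1
  ¬doomed-1 (inj₁ ())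
  ¬doomed-1 (inj₂ (q , pq , q∣1 , _)) = ¬prime[1] (subst Prime (∣1⇒≡1 q∣1) pq)

  doomed-* : ∀ x y → Doomed g (x * y) ⇔ (Doomed g x ⊎ Doomed g y)
  doomed-* x y = mk⇔ split [ doomed-∣ (m∣m*n y) , doomed-∣ (n∣m*n x) ]
    where
    split : Doomed g (x * y) → Doomed g x ⊎ Doomed g y
    split (inj₁ xy≡0) = map inj₁ inj₁ (m*n≡0⇒m≡0∨n≡0 x xy≡0)
    split (inj₂ (q , pq , q∣xy , gq≡0)) =
      map (λ q∣x → inj₂ (q , pq , q∣x , gq≡0)) (λ q∣y → inj₂ (q , pq , q∣y , gq≡0))
        (euclidsLemma x y pq q∣xy)

  doomedPrime : ∀ {p} → Prime p → Doomed g p → g p ≡ 0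
  doomedPrime pp (inj₁ refl) = contradiction pp ¬prime[0]
  doomedPrime pp (inj₂ (q , pq , q∣p , gq≡0)) = subst (λ t → g t ≡ 0) (primeDivisorOfPrime pp pq q∣p) gq≡0

  doomedPrimePower : ∀ {p} a → Prime p → Doomed g (p ^ a) → g p ≡ 0
  doomedPrimePower zero pp d = contradiction d ¬doomed-1
  doomedPrimePower {p} (suc a) pp d =
    [ doomedPrime pp , doomedPrimePower a pp ] (Equivalence.to (doomed-* p (p ^ a)) d)

module Shrinking
    (f : ℕ → ℕ)
    (mult : Multiplicative f)
    (shrinksPrimePowers : (p α : ℕ) → Prime p → α ≥ 1 → f (p ^ α) < p ^ α)
    (f0 : f 0 ≡ 0)
  where

  fixesSmall : ∀ {c} → c ≤ 1 → f c ≡ c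
  fixesSmall {zero} _ = f0
  fixesSmall {suc zero} _ = proj₁ mult
  fixesSmall {suc (suc _)} (s≤s ())

  f-split : ∀ {n} (s : PrimePowerSplit n) → let open PrimePowerSplit s in f n ≡ f (p ^ a) * f m
  f-split s = trans (cong f n≡pᵃm) (proj₂ mult (p ^ a) m (≤-trans (s≤s z≤n) pᵃ≥2) m≥1 coprime)
    where open PrimePowerSplit s

  decreasesBelow : ∀ {n} → n ≥ 2 → (∀ {k} → k < n → f k ≤ k) → f n < n
  decreasesBelow {n} n≥2 le-below = begin-strict
    f n             ≡⟨ f-split s ⟩
    f (p ^ a) * f m ≤⟨ *-monoʳ-≤ (f (p ^ a)) (le-below m<n) ⟩
    f (p ^ a) * m   <⟨ *-monoˡ-< m {{>-nonZero m≥1}} (shrinksPrimePowers p a prime a≥1) ⟩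
    p ^ a * m       ≡⟨ n≡pᵃm ⟨
    n               ∎
    where
    s = primePowerSplit n n≥2
    open PrimePowerSplit s
    open ≤-Reasoning

  -- f ≤ id follows from decreasesBelow by strong induction, and then
  -- decreasesBelow applies to every n ≥ 2.
  decreases : ∀ {n} → n ≥ 2 → f n < n
  decreases n≥2 = decreasesBelow n≥2 λ {k} _ → f-le k
    where
    f-le : ∀ n → f n ≤ n
    f-le = <-rec _ λ n le-below → case n ≤? 1 of λ where
      (yes n≤1) → ≤-reflexive (fixesSmall n≤1)
      (no n≰1) → <⇒≤ (decreasesBelow (≰⇒> n≰1) le-below)

module Characterisation
    (f : ℕ → ℕ)
    (mult : Multiplicative f)
    (I : (p α : ℕ) → Prime p → α ≥ 1 → f (p ^ α) < p ^ α)
    (II : (p α : ℕ) → Prime p → α ≥ 1 → f p ∣ f (p ^ α))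
    (III : (p α q : ℕ) → Prime p → α ≥ 1 → Prime q → q ∣ f (p ^ α) → q ∣ p * f p)
    (f0 : f 0 ≡ 0)
  where

  open Shrinking f mult I f0
  open Descent f fixesSmall decreases public using (H≤1)
  open Descent f fixesSmall decreases using (f-le; H-invariant)
  open Equivalence using (to; from)

  characterisationStep : ∀ {n} → n ≥ 2 → (∀ {k} → k < n → H f k ≡ 0 ⇔ Doomed (H f) k)
                       → H f n ≡ 0 ⇔ Doomed (H f) n
  characterisationStep {n} n≥2 ih = mk⇔ dying⇒doomed doomed⇒dying
    where
    s = primePowerSplit n n≥2
    open PrimePowerSplit s

    fn<n : f n < n
    fn<n = decreases n≥2
    fp<n : f p < n
    fp<n = <-≤-trans (decreases (prime≥2 prime)) (∣⇒≤ {{>-nonZero (≤-trans (s≤s z≤n) n≥2)}} p∣n)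
    fm<n : f m < n
    fm<n = ≤-<-trans (f-le m) m<n

    -- Since H k = H (f k), the induction hypothesis at f k speaks about k.
    dying⇒doomedImage : ∀ {k} → f k < n → H f k ≡ 0 → Doomed (H f) (f k)
    dying⇒doomedImage {k} fk<n Hk≡0 = to (ih fk<n) (trans (H-invariant k) Hk≡0)
    doomedImage⇒dying : ∀ {k} → f k < n → Doomed (H f) (f k) → H f k ≡ 0
    doomedImage⇒dying {k} fk<n d = trans (sym (H-invariant k)) (from (ih fk<n) d)

    -- By (III), every prime divisor of f (p ^ a) divides p * f p.
    doomedPrimePart⇒p-dying : Doomed (H f) (f (p ^ a)) → H f p ≡ 0
    doomedPrimePart⇒p-dying d =
      [ doomedPrime prime , doomedImage⇒dying fp<n ] (to (doomed-* p (f p)) p*fp-doomed)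
      where
      p*fp-doomed : Doomed (H f) (p * f p)
      p*fp-doomed = doomed-transfer (λ q pq → III p a q prime a≥1 pq) d

    dying⇒doomed : H f n ≡ 0 → Doomed (H f) n
    dying⇒doomed Hn≡0 = [ fromPrimePart , fromCofactor ] (to (doomed-* (f (p ^ a)) (f m)) fn-doomed)
      where
      fn-doomed : Doomed (H f) (f (p ^ a) * f m)
      fn-doomed = subst (Doomed (H f)) (f-split s) (dying⇒doomedImage fn<n Hn≡0)
      fromPrimePart : Doomed (H f) (f (p ^ a)) → Doomed (H f) n
      fromPrimePart d = inj₂ (p , prime , p∣n , doomedPrimePart⇒p-dying d)
      fromCofactor : Doomed (H f) (f m) → Doomed (H f) n
      fromCofactor d = doomed-∣ m∣n (to (ih m<n) (doomedImage⇒dying fm<n d))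

    doomed⇒dying : Doomed (H f) n → H f n ≡ 0
    doomed⇒dying d = doomedImage⇒dying fn<n (subst (Doomed (H f)) (sym (f-split s)) fn-doomed)
      where
      toPrimePart : Doomed (H f) (p ^ a) → Doomed (H f) (f (p ^ a))
      toPrimePart d = doomed-∣ (II p a prime a≥1) (dying⇒doomedImage fp<n (doomedPrimePower a prime d))
      toCofactor : Doomed (H f) m → Doomed (H f) (f m)
      toCofactor d = dying⇒doomedImage fm<n (from (ih m<n) d)
      fn-doomed : Doomed (H f) (f (p ^ a) * f m)
      fn-doomed = from (doomed-* _ _) (map toPrimePart toCofactor
                    (to (doomed-* (p ^ a) m) (subst (Doomed (H f)) n≡pᵃm d)))

  characterisation : ∀ n → H f n ≡ 0 ⇔ Doomed (H f) n
  characterisation = <-rec _ λ where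
    zero _ → mk⇔ (λ _ → inj₁ refl) (λ _ → refl)
    (suc zero) _ → mk⇔ (λ H1≡0 → contradiction (trans (sym (proj₁ mult)) H1≡0) λ ()) (λ d → contradiction d ¬doomed-1)
    (suc (suc _)) ih → characterisationStep (s≤s (s≤s z≤n)) ih

zeroOneProduct : ∀ {a b c} → a ≤ 1 → b ≤ 1 → c ≤ 1 → (c ≡ 0 ⇔ (a ≡ 0 ⊎ b ≡ 0)) → c ≡ a * b
zeroOneProduct {zero} _ _ _ c≡0⇔ = Equivalence.from c≡0⇔ (inj₁ refl)
zeroOneProduct {suc zero} {zero} _ _ _ c≡0⇔ = Equivalence.from c≡0⇔ (inj₂ refl)
zeroOneProduct {suc zero} {suc zero} {zero} _ _ _ c≡0⇔ with Equivalence.to c≡0⇔ refl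
... | inj₁ ()
... | inj₂ ()
zeroOneProduct {suc zero} {suc zero} {suc zero} _ _ _ _ = refl
zeroOneProduct {suc (suc _)} (s≤s ())
zeroOneProduct {_} {suc (suc _)} _ (s≤s ())
zeroOneProduct {_} {_} {suc (suc _)} _ _ (s≤s ())

-- H f (x * y) = 0 ⇔ x * y doomed ⇔ x or y doomed ⇔ H f x = 0 or H f y = 0.
-- (The identity in fact holds for all x, y, including 0.)
theorem1p3 : (f : ℕ → ℕ)
    → Multiplicative f
    → ((p α : ℕ) → Prime p → α ≥ 1 → f (p ^ α) < p ^ α)
    → ((p α : ℕ) → Prime p → α ≥ 1 → f p ∣ f (p ^ α))
    → ((p α q : ℕ) → Prime p → α ≥ 1 → Prime q → q ∣ f (p ^ α) → q ∣ p * f p)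
    → f 0 ≡ 0
    → (x y : ℕ) → x ≥ 1 → y ≥ 1 → H f (x * y) ≡ H f x * H f y
theorem1p3 f mult I II III f0 x y _ _ = zeroOneProduct (H≤1 x) (H≤1 y) (H≤1 (x * y)) vanishing
  where
  open Characterisation f mult I II III f0
  vanishing : H f (x * y) ≡ 0 ⇔ (H f x ≡ 0 ⊎ H f y ≡ 0)
  vanishing = ⇔-trans (characterisation (x * y))
                (⇔-trans (doomed-* x y) (⇔-sym (characterisation x ⊎-⇔ characterisation y)))
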